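{- Let $G$ be a strongly connected simple digraph that is critical, i.e. has no non-critical arrow. If $G$ contains two vertices $x,y$ with both arrows $(x,y)$ and $(y,x)$ (an induced $\mathcal{C}_2$), then both arrows $(x,y)$ and $(y,x)$ are bridges of $G$.
   Context: For a strongly connected digraph $G$, $|x,y|_G$ is the length of a shortest directed path from $x$ to $y$ and $\sigma(G)=\sum_{x\neq y}|x,y|_G$ over ordered pairs. The symmetric version $\overline{G}$ of $G=(V,A)$ has arrow $(i,j)$ iff $(i,j)\in A$ or $(j,i)\in A$. An arrow $a$ of a strongly connected digraph $G$ is a bridge if $G-a$ is not strongly connected. An arrow $a$ is non-critical if $G-a$ is strongly connected and $\sigma(G)-\sigma(\overline{G}) < \sigma(G-a)-\sigma(\overline{G-a})$. -}

module Defs where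

open import Data.Nat using (ℕ; zero; suc)
open import Data.Bool using (Bool; true; false; _∧_; _∨_; not; if_then_else_)
open import Data.Fin using (Fin; _≟_)
open import Data.List using (List; []; _∷_; map; allFin)
open import Data.Nat.ListAction using (sum)
open import Data.Bool.ListAction using (any)
open import Data.Product using (∃-syntax; _×_)
open import Data.Integer as ℤ using (ℤ; +_; _-_)
open import Relation.Nullary using (¬_)
open import Relation.Nullary.Decidable using (⌊_⌋)
open import Relation.Binary.PropositionalEquality using (_≡_)

-- Being a relation,
-- there are no multiple arrows; simplicity additionally asks for no loops.
Digraph : ℕ → Set
Digraph n = Fin n → Fin n → Bool

Simple : ∀ {n} → Digraph n → Set
Simple G = ∀ u → G u u ≡ false

Arrow : ∀ {n} → Digraph n → Fin n → Fin n → Set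
Arrow G u v = G u v ≡ true

data Walk {n : ℕ} (G : Digraph n) : ℕ → Fin n → Fin n → Set where
  here : ∀ {x} → Walk G 0 x x
  step : ∀ {k x y z} → G x y ≡ true → Walk G k y z → Walk G (suc k) x z

StronglyConnected : ∀ {n} → Digraph n → Set
StronglyConnected {n} G = ∀ (x y : Fin n) → ∃[ k ] Walk G k x y

reachWithin : ∀ {n} → Digraph n → ℕ → Fin n → Fin n → Bool
reachWithin {n} G zero    x y = ⌊ x ≟ y ⌋
reachWithin {n} G (suc k) x y =
  reachWithin G k x y ∨ any (λ z → reachWithin G k x z ∧ G z y) (allFin n)

-- least k ≤ bound satisfying p, searching upward from start (returns bound+start if none)
leastFrom : (ℕ → Bool) → ℕ → ℕ → ℕ
leastFrom p zero      s = s
leastFrom p (suc fuel) s = if p s then s else leastFrom p fuel (suc s)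

-- |x,y|_G : length of a shortest directed path from x to y
-- (= least k with a walk of length ≤ k; in a digraph on n vertices such
-- a k ≤ n exists whenever y is reachable from x).
dist : ∀ {n} → Digraph n → Fin n → Fin n → ℕ
dist {n} G x y = leastFrom (λ k → reachWithin G k x y) n 0

σ : ∀ {n} → Digraph n → ℕ
σ {n} G = sum (map (λ x → sum (map (λ y → if ⌊ x ≟ y ⌋ then 0 else dist G x y) (allFin n))) (allFin n))

symm : ∀ {n} → Digraph n → Digraph n
symm G i j = G i j ∨ G j i

delete : ∀ {n} → Digraph n → Fin n → Fin n → Digraph n
delete G i j u v = G u v ∧ not (⌊ u ≟ i ⌋ ∧ ⌊ v ≟ j ⌋)

Bridge : ∀ {n} → Digraph n → Fin n → Fin n → Set
Bridge G i j = Arrow G i j × ¬ StronglyConnected (delete G i j)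

NonCritical : ∀ {n} → Digraph n → Fin n → Fin n → Set
NonCritical G i j =
  Arrow G i j × StronglyConnected (delete G i j) ×
  ((+ σ G) - (+ σ (symm G)) ℤ.< (+ σ (delete G i j)) - (+ σ (symm (delete G i j))))

Critical : ∀ {n} → Digraph n → Set
Critical {n} G = ∀ (i j : Fin n) → ¬ NonCritical G i j

module Submission where

-- Let x → y → x be a 2-cycle of the simple critical digraph G and
-- let D = G - (x , y).  Since the reverse arrow y → x survives in D, the
-- symmetric versions of D and G coincide, so σ(symm D) = σ(symm G).  On the
-- other hand D is a subgraph of G, so no distance decreases, while |x,y|
-- grows from 1 in G to at least 2 in D (x ≠ y, and D has no arrow x → y);
-- hence σ(G) < σ(D).  If D were strongly connected, (x , y) would therefore
-- be non-critical, contradicting criticality: (x , y) is a bridge, and by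
-- symmetry so is (y , x).

open import Defs
open import Data.Nat using (ℕ; zero; suc; _+_; _≤_; _<_; _≤′_; ≤′-refl; ≤′-step; z≤n; s≤s)
open import Data.Nat.Properties
  using (≤-refl; ≤-trans; ≤-<-trans; ≤-antisym; n≤1+n; +-suc; +-identityʳ;
         +-mono-≤; +-mono-<-≤; +-mono-≤-<; m≤n⇒m<n∨m≡n; <⇒≱; ≰⇒>; ≤⇒≤′)
open import Data.Fin using (Fin; _≟_; zero)
open import Data.Bool using (Bool; true; false; T; not; _∧_; if_then_else_)
open import Data.Bool.Properties using (T-≡; T-∧; T-∨)
open import Data.Unit using (tt)
open import Data.List using ([]; _∷_; map; allFin)
open import Data.List.Relation.Unary.Any using (here; there; satisfied)
open import Data.List.Relation.Unary.Any.Properties using (any⁺; any⁻)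
open import Data.List.Membership.Propositional using (_∈_; lose)
open import Data.List.Membership.Propositional.Properties using (∈-allFin)
open import Data.Nat.ListAction using (sum)
open import Data.Product using (∃-syntax; _×_; _,_; proj₁; proj₂)
open import Data.Sum using (_⊎_; inj₁; inj₂)
import Data.Sum as Sum
open import Data.Empty using (⊥-elim)
open import Data.Integer as ℤ using (+_; _-_; +<+)
open import Data.Integer.Properties using (+-monoˡ-<)
open import Function.Bundles using (Equivalence)
open import Relation.Nullary using (¬_; yes; no; _×-dec_)
open import Relation.Nullary.Decidable using (⌊_⌋; toWitness; fromWitness)
open import Relation.Binary.PropositionalEquality using (_≡_; refl; sym; trans; subst)

open Equivalence using (to; from)

distinct⇒1<n : ∀ {n} {a b : Fin n} → ¬ a ≡ b → 1 < n
distinct⇒1<n {suc zero}    {zero} {zero} a≢b = ⊥-elim (a≢b refl)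
distinct⇒1<n {suc (suc _)} _ = s≤s (s≤s z≤n)

arrow⇒distinct : ∀ {n} {G : Digraph n} {x y} → Simple G → Arrow G x y → ¬ x ≡ y
arrow⇒distinct {x = x} simple xy refl = subst T (simple x) (from T-≡ xy)

ExtendsWithin : ∀ {n} → Digraph n → ℕ → Fin n → Fin n → Set
ExtendsWithin G k x y = ∃[ z ] (T (reachWithin G k x z) × T (G z y))

reach-suc⁻ : ∀ {n} {G : Digraph n} {k x y} → T (reachWithin G (suc k) x y) →
             T (reachWithin G k x y) ⊎ ExtendsWithin G k x y
reach-suc⁻ {n} {G} {k} {x} {y} r with to T-∨ r
... | inj₁ shorter  = inj₁ shorter
... | inj₂ extended =
  let (z , t) = satisfied (any⁻ (λ z → reachWithin G k x z ∧ G z y) (allFin n) extended)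
  in  inj₂ (z , to T-∧ t)

reach-suc⁺ : ∀ {n} {G : Digraph n} {k x y} → T (reachWithin G k x y) ⊎ ExtendsWithin G k x y →
             T (reachWithin G (suc k) x y)
reach-suc⁺ (inj₁ shorter)           = from T-∨ (inj₁ shorter)
reach-suc⁺ (inj₂ (z , walk , arrow)) =
  from T-∨ (inj₂ (any⁺ _ (lose (∈-allFin z) (from T-∧ (walk , arrow)))))

reach-weaken : ∀ {n} {G : Digraph n} {j k x y} → j ≤ k →
               T (reachWithin G j x y) → T (reachWithin G k x y)
reach-weaken j≤k = go (≤⇒≤′ j≤k)
  where
  go : ∀ {n} {G : Digraph n} {j k x y} → j ≤′ k → T (reachWithin G j x y) → T (reachWithin G k x y)
  go ≤′-refl        r = r
  go {G = G} {k = suc k} {x} {y} (≤′-step j≤′k) r = reach-suc⁺ {G = G} {k} {x} {y} (inj₁ (go j≤′k r))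

reach-one⁻ : ∀ {n} {G : Digraph n} {x y} → ¬ x ≡ y → T (reachWithin G 1 x y) → T (G x y)
reach-one⁻ {G = G} {x} {y} x≢y r with reach-suc⁻ {G = G} {0} {x} {y} r
... | inj₁ same                  = ⊥-elim (x≢y (toWitness same))
... | inj₂ (z , x≡z , arrow)     = subst (λ w → T (G w y)) (sym (toWitness x≡z)) arrow

reach-one⁺ : ∀ {n} {G : Digraph n} {x y} → T (G x y) → T (reachWithin G 1 x y)
reach-one⁺ {G = G} {x} {y} arrow = reach-suc⁺ {G = G} {0} {x} {y} (inj₂ (x , fromWitness refl , arrow))

leastFrom-stops : ∀ (p : ℕ → Bool) f s → T (p (leastFrom p f s)) ⊎ leastFrom p f s ≡ s + f
leastFrom-stops p zero    s = inj₂ (sym (+-identityʳ s))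
leastFrom-stops p (suc f) s with p s in ps
... | true  = inj₁ (subst T (sym ps) tt)
... | false = Sum.map₂ (λ e → trans e (sym (+-suc s f))) (leastFrom-stops p f (suc s))

leastFrom-≤ : ∀ (p : ℕ → Bool) f s {k} → s ≤ k → k < s + f → T (p k) → leastFrom p f s ≤ k
leastFrom-≤ p zero    s {k} s≤k k<s pk = ⊥-elim (<⇒≱ (subst (k <_) (+-identityʳ s) k<s) s≤k)
leastFrom-≤ p (suc f) s {k} s≤k k<s+f pk with p s in ps
... | true  = s≤k
... | false with m≤n⇒m<n∨m≡n s≤k
...   | inj₁ s<k  = leastFrom-≤ p f (suc s) s<k (subst (k <_) (+-suc s f) k<s+f) pk
...   | inj₂ refl = ⊥-elim (subst T ps pk)

leastFrom-lower : ∀ (p : ℕ → Bool) f s → s ≤ leastFrom p f s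
leastFrom-lower p zero    s = ≤-refl
leastFrom-lower p (suc f) s with p s
... | true  = ≤-refl
... | false = ≤-trans (n≤1+n s) (leastFrom-lower p f (suc s))

leastFrom-mono : ∀ (p q : ℕ → Bool) → (∀ k → T (q k) → T (p k)) → ∀ f s →
                 leastFrom p f s ≤ leastFrom q f s
leastFrom-mono p q q⇒p zero    s = ≤-refl
leastFrom-mono p q q⇒p (suc f) s with q s | q⇒p s
... | true  | q⇒ps with p s | q⇒ps tt
...   | true  | _  = ≤-refl
...   | false | ()
leastFrom-mono p q q⇒p (suc f) s | false | _ with p s
...   | true  = ≤-trans (n≤1+n s) (leastFrom-lower q f (suc s))
...   | false = leastFrom-mono p q q⇒p f (suc s)

dist-≤⁺ : ∀ {n} {G : Digraph n} {k x y} → k < n → T (reachWithin G k x y) → dist G x y ≤ k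
dist-≤⁺ {n} {G} {k} {x} {y} k<n = leastFrom-≤ (λ j → reachWithin G j x y) n 0 z≤n k<n

dist-≤⁻ : ∀ {n} {G : Digraph n} {k x y} → k < n → dist G x y ≤ k → T (reachWithin G k x y)
dist-≤⁻ {n} {G} {k} {x} {y} k<n d≤k with leastFrom-stops (λ j → reachWithin G j x y) n 0
... | inj₁ found     = reach-weaken d≤k found
... | inj₂ exhausted = ⊥-elim (<⇒≱ k<n (subst (_≤ k) exhausted d≤k))

dist≤1⇒arrow : ∀ {n} {G : Digraph n} {x y} → ¬ x ≡ y → dist G x y ≤ 1 → T (G x y)
dist≤1⇒arrow {G = G} {x} {y} x≢y d≤1 =
  reach-one⁻ {G = G} x≢y (dist-≤⁻ {G = G} {1} {x} {y} (distinct⇒1<n x≢y) d≤1)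

arrow⇒dist≤1 : ∀ {n} {G : Digraph n} {x y} → ¬ x ≡ y → T (G x y) → dist G x y ≤ 1
arrow⇒dist≤1 {G = G} {x} {y} x≢y arrow =
  dist-≤⁺ {G = G} {1} {x} {y} (distinct⇒1<n x≢y) (reach-one⁺ {G = G} arrow)

_⊆_ : ∀ {n} → Digraph n → Digraph n → Set
H ⊆ G = ∀ u v → T (H u v) → T (G u v)

reach-⊆ : ∀ {n} {H G : Digraph n} → H ⊆ G → ∀ k {x y} →
          T (reachWithin H k x y) → T (reachWithin G k x y)
reach-⊆ H⊆G zero            r = r
reach-⊆ {H = H} {G} H⊆G (suc k) {x} {y} r with reach-suc⁻ {G = H} {k} {x} {y} r
... | inj₁ shorter            = reach-suc⁺ {G = G} {k} {x} {y} (inj₁ (reach-⊆ H⊆G k shorter))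
... | inj₂ (z , walk , arrow) =
  reach-suc⁺ {G = G} {k} {x} {y} (inj₂ (z , reach-⊆ H⊆G k walk , H⊆G z y arrow))

dist-antitone : ∀ {n} {H G : Digraph n} → H ⊆ G → ∀ x y → dist G x y ≤ dist H x y
dist-antitone {n} {H} {G} H⊆G x y =
  leastFrom-mono (λ k → reachWithin G k x y) (λ k → reachWithin H k x y)
                 (λ k → reach-⊆ H⊆G k) n 0

offDiagDist : ∀ {n} → Digraph n → Fin n → Fin n → ℕ
offDiagDist G x y = if ⌊ x ≟ y ⌋ then 0 else dist G x y

offDiagDist-antitone : ∀ {n} {H G : Digraph n} → H ⊆ G → ∀ x y → offDiagDist G x y ≤ offDiagDist H x y
offDiagDist-antitone H⊆G x y with x ≟ y
... | yes _ = z≤n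
... | no  _ = dist-antitone H⊆G x y

offDiagDist-strict : ∀ {n} {H G : Digraph n} {x y} → ¬ x ≡ y → dist G x y < dist H x y →
                     offDiagDist G x y < offDiagDist H x y
offDiagDist-strict {x = x} {y} x≢y lt with x ≟ y
... | yes x≡y = ⊥-elim (x≢y x≡y)
... | no  _   = lt

sum-mono : ∀ {A : Set} (f g : A → ℕ) → (∀ a → f a ≤ g a) → ∀ l → sum (map f l) ≤ sum (map g l)
sum-mono f g f≤g []      = z≤n
sum-mono f g f≤g (a ∷ l) = +-mono-≤ (f≤g a) (sum-mono f g f≤g l)

sum-strict : ∀ {A : Set} (f g : A → ℕ) → (∀ a → f a ≤ g a) → ∀ {a} l → a ∈ l → f a < g a →
             sum (map f l) < sum (map g l)
sum-strict f g f≤g (b ∷ l) (here refl) lt = +-mono-<-≤ lt (sum-mono f g f≤g l)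
sum-strict f g f≤g (b ∷ l) (there a∈l) lt = +-mono-≤-< (f≤g b) (sum-strict f g f≤g l a∈l lt)

rowSum : ∀ {n} → Digraph n → Fin n → ℕ
rowSum {n} G x = sum (map (offDiagDist G x) (allFin n))

rowSum-antitone : ∀ {n} {H G : Digraph n} → H ⊆ G → ∀ x → rowSum G x ≤ rowSum H x
rowSum-antitone {n} {H} {G} H⊆G x =
  sum-mono (offDiagDist G x) (offDiagDist H x) (offDiagDist-antitone H⊆G x) (allFin n)

σ-antitone : ∀ {n} {H G : Digraph n} → H ⊆ G → σ G ≤ σ H
σ-antitone {n} {H} {G} H⊆G = sum-mono (rowSum G) (rowSum H) (rowSum-antitone H⊆G) (allFin n)

σ-strict : ∀ {n} {H G : Digraph n} {x y} → H ⊆ G → ¬ x ≡ y → dist G x y < dist H x y → σ G < σ H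
σ-strict {n} {H} {G} {x} {y} H⊆G x≢y lt =
  sum-strict (rowSum G) (rowSum H) (rowSum-antitone H⊆G) (allFin n) (∈-allFin x)
    (sum-strict (offDiagDist G x) (offDiagDist H x) (offDiagDist-antitone H⊆G x)
                (allFin n) (∈-allFin y) (offDiagDist-strict {H = H} {G} x≢y lt))

σ-cong : ∀ {n} {H G : Digraph n} → H ⊆ G → G ⊆ H → σ H ≡ σ G
σ-cong H⊆G G⊆H = ≤-antisym (σ-antitone G⊆H) (σ-antitone H⊆G)

delete-⊆ : ∀ {n} {G : Digraph n} i j → delete G i j ⊆ G
delete-⊆ i j u v t = proj₁ (to T-∧ t)

guard-at : ∀ {n} (i j : Fin n) → ⌊ i ≟ i ⌋ ∧ ⌊ j ≟ j ⌋ ≡ true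
guard-at i j with i ≟ i | j ≟ j
... | yes _   | yes _   = refl
... | yes _   | no j≢j  = ⊥-elim (j≢j refl)
... | no i≢i  | _       = ⊥-elim (i≢i refl)

guard-elsewhere : ∀ {n} {i j u v : Fin n} → ¬ (u ≡ i × v ≡ j) → ⌊ u ≟ i ⌋ ∧ ⌊ v ≟ j ⌋ ≡ false
guard-elsewhere {i = i} {j} {u} {v} uv≢ij with u ≟ i | v ≟ j
... | yes u≡i | yes v≡j = ⊥-elim (uv≢ij (u≡i , v≡j))
... | yes _   | no _    = refl
... | no _    | _       = refl

delete-removes : ∀ {n} {G : Digraph n} i j → ¬ T (delete G i j i j)
delete-removes i j t = subst (λ b → T (not b)) (guard-at i j) (proj₂ (to T-∧ t))

delete-keeps : ∀ {n} {G : Digraph n} {i j u v} → ¬ (u ≡ i × v ≡ j) → T (G u v) → T (delete G i j u v)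
delete-keeps uv≢ij t = from T-∧ (t , subst (λ b → T (not b)) (sym (guard-elsewhere uv≢ij)) tt)

-- Symmetrisation is monotone, and deleting one arrow of a 2-cycle does not
-- change the symmetric version, since the reverse arrow survives.
symm-⊆ : ∀ {n} {H G : Digraph n} → H ⊆ G → symm H ⊆ symm G
symm-⊆ H⊆G u v t = from T-∨ (Sum.map (H⊆G u v) (H⊆G v u) (to T-∨ t))

symm-delete-⊇ : ∀ {n} {G : Digraph n} {i j} → ¬ i ≡ j → T (G j i) → symm G ⊆ symm (delete G i j)
symm-delete-⊇ {G = G} {i} {j} i≢j ji u v t with (u ≟ i) ×-dec (v ≟ j)
... | yes (refl , refl) = from T-∨ (inj₂ (delete-keeps {G = G} reverse≢ij ji))
  where
  reverse≢ij : ¬ (j ≡ i × i ≡ j)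
  reverse≢ij (_ , i≡j) = i≢j i≡j
... | no uv≢ij with (v ≟ i) ×-dec (u ≟ j)
...   | yes (refl , refl) = from T-∨ (inj₁ (delete-keeps {G = G} uv≢ij ji))
...   | no vu≢ij          =
  from T-∨ (Sum.map (delete-keeps {G = G} uv≢ij) (delete-keeps {G = G} vu≢ij) (to T-∨ t))

-- Deletion leaves the
-- symmetric version unchanged but raises |x,y| from 1 to at least 2.
twoCycle-nonCritical : ∀ {n} {G : Digraph n} {x y} → Simple G → Arrow G x y → Arrow G y x →
                       StronglyConnected (delete G x y) → NonCritical G x y
twoCycle-nonCritical {n} {G} {x} {y} simple xy yx connected = xy , connected , gap-grows
  where
  D : Digraph n
  D = delete G x y

  x≢y : ¬ x ≡ y
  x≢y = arrow⇒distinct simple xy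

  distance-grows : dist G x y < dist D x y
  distance-grows =
    ≤-<-trans (arrow⇒dist≤1 x≢y (from T-≡ xy))
              (≰⇒> (λ d≤1 → delete-removes {G = G} x y (dist≤1⇒arrow {G = D} x≢y d≤1)))

  σ-grows : σ G < σ D
  σ-grows = σ-strict (delete-⊆ x y) x≢y distance-grows

  σ-symm-same : σ (symm D) ≡ σ (symm G)
  σ-symm-same = σ-cong (symm-⊆ {H = D} {G} (delete-⊆ x y)) (symm-delete-⊇ {G = G} x≢y (from T-≡ yx))

  gap-grows : (+ σ G) - (+ σ (symm G)) ℤ.< (+ σ D) - (+ σ (symm D))
  gap-grows rewrite σ-symm-same = +-monoˡ-< (ℤ.- (+ σ (symm G))) (+<+ σ-grows)

twoCycle-bridge : ∀ {n} {G : Digraph n} {x y} → Simple G → Critical G →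
                  Arrow G x y → Arrow G y x → Bridge G x y
twoCycle-bridge {x = x} {y} simple critical xy yx =
  xy , λ connected → critical x y (twoCycle-nonCritical simple xy yx connected)

lemma6 : (n : ℕ) (G : Digraph n) → Simple G → StronglyConnected G → Critical G →
           (x y : Fin n) → Arrow G x y → Arrow G y x →
           Bridge G x y × Bridge G y x
lemma6 n G simple _ critical x y xy yx =
  twoCycle-bridge simple critical xy yx , twoCycle-bridge simple critical yx xy
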